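{- Let $n \geq 2$ and let $P_n$ be the path on $n$ vertices. Then the $\tfrac12$-packing number satisfies $\tfrac{1}{2}\beta\text{ -pack}(P_n) = n-2$, and for every $\tfrac12$-packing set $S$ of $P_n$ the subgraph of $P_n$ induced by $V - S$ is connected.
   Context: Let $G=(V,E)$ be a graph, $N(v)=\{u : uv\in E\}$ the open neighborhood of $v$, and fix $\beta$ with $0<\beta\le 1$. A set $S\subsetneq V$ (a proper subset) is a $\beta$-packing set of $G$ if (i) for every $v\in V-S$, $|N(v)\cap S|\le \beta\,|N(v)|$ (the $\beta$-packing property), and (ii) $S$ is maximal with respect to inclusion among proper subsets of $V$ having the $\beta$-packing property. The $\beta$-packing number $\beta\text{ -pack}(G)$ is the maximum cardinality of a $\beta$-packing set of $G$. For $\beta=\tfrac12$ these are called $\tfrac12$-packing sets and the number is written $\tfrac12\beta\text{ -pack}(G)$. -}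

module Defs where

open import Data.Nat using (ℕ; zero; suc; _*_; _≤_; _≡ᵇ_)
open import Data.Bool using (Bool; true; false; _∨_)
open import Data.Fin using (Fin; toℕ)
open import Data.Fin.Subset using (Subset; _∈_; _∉_; _∩_; _⊆_; ∣_∣)
open import Data.Vec using (tabulate)
open import Data.Product using (∃; _×_)
open import Relation.Binary.PropositionalEquality using (_≡_)

-- A (loopless, undirected) graph on vertex set Fin n, given by a Boolean
-- adjacency function.
Graph : ℕ → Set
Graph n = Fin n → Fin n → Bool

pathGraph : (n : ℕ) → Graph n
pathGraph n i j = (toℕ i ≡ᵇ suc (toℕ j)) ∨ (toℕ j ≡ᵇ suc (toℕ i))

N : ∀ {n} → Graph n → Fin n → Subset n
N G v = tabulate (λ u → G v u)

Proper : ∀ {n} → Subset n → Set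
Proper S = ∃ λ v → v ∉ S

-- β-packing property for β = p / q (q > 0):
-- for every v ∉ S,  |N(v) ∩ S| ≤ β |N(v)|,  i.e.  q |N(v) ∩ S| ≤ p |N(v)|.
HasPackingProperty : ∀ {n} → (p q : ℕ) → Graph n → Subset n → Set
HasPackingProperty p q G S =
  ∀ v → v ∉ S → q * ∣ N G v ∩ S ∣ ≤ p * ∣ N G v ∣

IsPackingSet : ∀ {n} → (p q : ℕ) → Graph n → Subset n → Set
IsPackingSet p q G S =
  Proper S × HasPackingProperty p q G S ×
  (∀ T → Proper T → HasPackingProperty p q G T → S ⊆ T → T ⊆ S)

IsPackingNumber : ∀ {n} → (p q : ℕ) → Graph n → ℕ → Set
IsPackingNumber p q G k =
  (∃ λ S → IsPackingSet p q G S × ∣ S ∣ ≡ k) ×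
  (∀ S → IsPackingSet p q G S → ∣ S ∣ ≤ k)

IsHalfPackingSet : ∀ {n} → Graph n → Subset n → Set
IsHalfPackingSet = IsPackingSet 1 2

IsHalfPackingNumber : ∀ {n} → Graph n → ℕ → Set
IsHalfPackingNumber = IsPackingNumber 1 2

data ReachIn {n} (G : Graph n) (X : Subset n) : Fin n → Fin n → Set where
  here : ∀ {u} → u ∈ X → ReachIn G X u u
  step : ∀ {u v w} → u ∈ X → G u v ≡ true → ReachIn G X v w → ReachIn G X u w

-- The subgraph of G induced by X is connected (X assumed nonempty where used).
InducedConnected : ∀ {n} → Graph n → Subset n → Set
InducedConnected G X = ∀ u w → u ∈ X → w ∈ X → ReachIn G X u w

-- In a graph without isolated vertices, a vertex outside a ½-packing set S
-- has a neighbour outside S, for otherwise all of its neighbours lie in S.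
-- So V − S contains an edge uv. If moreover no vertex has more than two
-- neighbours, V − {u, v} itself has the ½-packing property, and maximality
-- forces S = V − {u, v}. Thus the ½-packing sets of such a graph, P_n for
-- n ≥ 2 among them, are exactly the complements of its edges.
module Submission where

open import Defs
open import Data.Nat using (ℕ; _≤_; _∸_)
open import Data.Fin.Subset using (Subset; ∁)
open import Data.Product using (_×_)

open import Data.Bool using (true)
import Data.Bool as Bool
open import Data.Bool.Properties using (∨-comm; T-∨; T-≡)
open import Data.Empty using (⊥-elim)
open import Data.Fin using (Fin; toℕ; inject₁) renaming (zero to fzero; suc to fsuc)
open import Data.Fin.Properties using (toℕ-injective; toℕ-inject₁; any?)
open import Data.Fin.Subset using (_∈_; _∉_; _∩_; _∪_; _⊆_; ∣_∣; ⁅_⁆; inside; outside)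
open import Data.Fin.Subset.Properties
  using ( _∈?_; nonempty?; Empty-unique; ∣⊥∣≡0; ∉⊥; ⊆-min; ⊆-antisym
        ; p⊆q⇒∣p∣≤∣q∣; p⊂q⇒∣p∣<∣q∣; x∈⁅x⁆; x∈⁅y⁆⇒x≡y; x≢y⇒x∉⁅y⁆; ∣⁅x⁆∣≡1
        ; p∩q⊆p; x∈p∩q⁺; x∈p∩q⁻; p⊆p∪q; x∈p∪q⁺; x∈p∪q⁻
        ; x∈p⇒x∉∁p; x∉∁p⇒x∈p; x∉p⇒x∈∁p; x∈∁p⇒x∉p; ∣∁p∣≡n∸∣p∣ )
open import Data.Nat using (suc; _*_; _+_; _<_; _≡ᵇ_; z≤n; s≤s; >-nonZero)
open import Data.Nat.Properties
  using ( ≤-trans; ≤-reflexive; ≤-antisym; <⇒≱; n≤1+n; +-suc; +-monoʳ-≤; *-monoʳ-≤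
        ; *-monoˡ-<; suc-injective; 1+n≢n; ≡ᵇ⇒≡; ≡⇒≡ᵇ )
open import Data.Product using (∃; ∃₂; _,_; proj₁; proj₂)
open import Data.Sum using (_⊎_; inj₁; inj₂; [_,_]; swap)
import Data.Sum as Sum
open import Data.Vec using ([]; _∷_)
open import Data.Vec.Properties using (lookup∘tabulate; []=⇒lookup; lookup⇒[]=)
open import Function using (_∘_; Equivalence)
open import Relation.Binary.Definitions using (Symmetric; Irreflexive)
open import Relation.Binary.PropositionalEquality
  using (_≡_; _≢_; refl; sym; trans; cong; cong₂; subst)
open import Relation.Nullary using (yes; no; ¬?)
open import Relation.Nullary.Decidable using (_×-dec_)

x∈p⇒0<∣p∣ : ∀ {n} {x : Fin n} {p} → x ∈ p → 0 < ∣ p ∣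
x∈p⇒0<∣p∣ {n} {x} {p} x∈p =
  subst (_< ∣ p ∣) (∣⊥∣≡0 n) (p⊂q⇒∣p∣<∣q∣ (⊆-min p , x , x∈p , ∉⊥))

∣p∣≤1 : ∀ {n} {p : Subset n} → (∀ {x y} → x ∈ p → y ∈ p → x ≡ y) → ∣ p ∣ ≤ 1
∣p∣≤1 {n} {p} unique with nonempty? p
... | no empty = ≤-trans (≤-reflexive (trans (cong ∣_∣ (Empty-unique empty)) (∣⊥∣≡0 n))) z≤n
... | yes (x , x∈p) = ≤-trans (p⊆q⇒∣p∣≤∣q∣ p⊆⁅x⁆) (≤-reflexive (∣⁅x⁆∣≡1 x))
  where
  p⊆⁅x⁆ : p ⊆ ⁅ x ⁆
  p⊆⁅x⁆ y∈p = subst (_∈ ⁅ x ⁆) (unique x∈p y∈p) (x∈⁅x⁆ x)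

∣p∪q∣≤∣p∣+∣q∣ : ∀ {n} (p q : Subset n) → ∣ p ∪ q ∣ ≤ ∣ p ∣ + ∣ q ∣
∣p∪q∣≤∣p∣+∣q∣ []            []            = z≤n
∣p∪q∣≤∣p∣+∣q∣ (inside  ∷ p) (outside ∷ q) = s≤s (∣p∪q∣≤∣p∣+∣q∣ p q)
∣p∪q∣≤∣p∣+∣q∣ (inside  ∷ p) (inside  ∷ q) =
  s≤s (≤-trans (∣p∪q∣≤∣p∣+∣q∣ p q) (+-monoʳ-≤ ∣ p ∣ (n≤1+n ∣ q ∣)))
∣p∪q∣≤∣p∣+∣q∣ (outside ∷ p) (inside  ∷ q) =
  subst (∣ p ∪ q ∣ <_) (sym (+-suc ∣ p ∣ ∣ q ∣)) (s≤s (∣p∪q∣≤∣p∣+∣q∣ p q))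
∣p∪q∣≤∣p∣+∣q∣ (outside ∷ p) (outside ∷ q) = ∣p∪q∣≤∣p∣+∣q∣ p q

∣⁅x⁆∪⁅y⁆∣≡2 : ∀ {n} {x y : Fin n} → x ≢ y → ∣ ⁅ x ⁆ ∪ ⁅ y ⁆ ∣ ≡ 2
∣⁅x⁆∪⁅y⁆∣≡2 {x = x} {y} x≢y = ≤-antisym at-most at-least
  where
  at-most : ∣ ⁅ x ⁆ ∪ ⁅ y ⁆ ∣ ≤ 2
  at-most = subst (∣ ⁅ x ⁆ ∪ ⁅ y ⁆ ∣ ≤_) (cong₂ _+_ (∣⁅x⁆∣≡1 x) (∣⁅x⁆∣≡1 y))
    (∣p∪q∣≤∣p∣+∣q∣ ⁅ x ⁆ ⁅ y ⁆)
  at-least : 2 ≤ ∣ ⁅ x ⁆ ∪ ⁅ y ⁆ ∣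
  at-least = subst (_< ∣ ⁅ x ⁆ ∪ ⁅ y ⁆ ∣) (∣⁅x⁆∣≡1 x)
    (p⊂q⇒∣p∣<∣q∣ (p⊆p∪q ⁅ y ⁆ , y , x∈p∪q⁺ (inj₂ (x∈⁅x⁆ y)) , x≢y⇒x∉⁅y⁆ (x≢y ∘ sym)))

∈⁅x⁆∪⁅y⁆⁻ : ∀ {n} {x y z : Fin n} → z ∈ ⁅ x ⁆ ∪ ⁅ y ⁆ → z ≡ x ⊎ z ≡ y
∈⁅x⁆∪⁅y⁆⁻ {x = x} {y} = Sum.map (x∈⁅y⁆⇒x≡y x) (x∈⁅y⁆⇒x≡y y) ∘ x∈p∪q⁻ ⁅ x ⁆ ⁅ y ⁆

x∈⁅x⁆∪⁅y⁆ : ∀ {n} {x y : Fin n} → x ∈ ⁅ x ⁆ ∪ ⁅ y ⁆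
x∈⁅x⁆∪⁅y⁆ {x = x} = x∈p∪q⁺ (inj₁ (x∈⁅x⁆ x))

y∈⁅x⁆∪⁅y⁆ : ∀ {n} {x y : Fin n} → y ∈ ⁅ x ⁆ ∪ ⁅ y ⁆
y∈⁅x⁆∪⁅y⁆ {y = y} = x∈p∪q⁺ (inj₂ (x∈⁅x⁆ y))

pair-cover : ∀ {A : Set} {u v w w' x : A} → w ≢ w' →
  w ≡ u ⊎ w ≡ v → w' ≡ u ⊎ w' ≡ v → x ≡ u ⊎ x ≡ v → x ≡ w ⊎ x ≡ w'
pair-cover w≢w' (inj₁ refl) (inj₁ refl) _ = ⊥-elim (w≢w' refl)
pair-cover _    (inj₁ refl) (inj₂ refl) x = x
pair-cover _    (inj₂ refl) (inj₁ refl) x = swap x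
pair-cover w≢w' (inj₂ refl) (inj₂ refl) _ = ⊥-elim (w≢w' refl)

j≤1⇒j<k⇒2*j≤k : ∀ {j k} → j ≤ 1 → j < k → 2 * j ≤ 1 * k
j≤1⇒j<k⇒2*j≤k z≤n       _               = z≤n
j≤1⇒j<k⇒2*j≤k (s≤s z≤n) (s≤s (s≤s z≤n)) = s≤s (s≤s z≤n)

Adjacent : ∀ {n} → Graph n → Fin n → Fin n → Set
Adjacent G u v = G u v ≡ true

∈N⁺ : ∀ {n} (G : Graph n) {v u} → Adjacent G v u → u ∈ N G v
∈N⁺ G {v} {u} vu = lookup⇒[]= u _ (trans (lookup∘tabulate (G v) u) vu)

∈N⁻ : ∀ {n} (G : Graph n) {v u} → u ∈ N G v → Adjacent G v u
∈N⁻ G {v} {u} u∈N = trans (sym (lookup∘tabulate (G v) u)) ([]=⇒lookup u∈N)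

NoIsolatedVertex : ∀ {n} → Graph n → Set
NoIsolatedVertex G = ∀ v → ∃ (Adjacent G v)

-- Maximum degree at most 2, phrased without counting.
AtMostTwoNeighbours : ∀ {n} → Graph n → Set
AtMostTwoNeighbours G = ∀ {a x y z} →
  Adjacent G a x → Adjacent G a y → Adjacent G a z → x ≡ y ⊎ y ≡ z ⊎ x ≡ z

record DegreesOneOrTwo {n} (G : Graph n) : Set where
  field
    symmetric           : Symmetric (Adjacent G)
    irreflexive         : Irreflexive _≡_ (Adjacent G)
    noIsolatedVertex    : NoIsolatedVertex G
    atMostTwoNeighbours : AtMostTwoNeighbours G

outsideNeighbour : ∀ {n} {G : Graph n} {S v} {p q} → p < q → NoIsolatedVertex G →
  HasPackingProperty p q G S → v ∉ S → ∃ λ u → Adjacent G v u × u ∉ S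
outsideNeighbour {G = G} {S} {v} {p} {q} p<q noIsolated packing v∉S
  with any? (λ u → (G v u Bool.≟ true) ×-dec ¬? (u ∈? S))
... | yes found = found
... | no none = ⊥-elim (<⇒≱ (*-monoˡ-< ∣ N G v ∣ {{>-nonZero 0<∣N∣}} p<q) q∣N∣≤p∣N∣)
  where
  0<∣N∣ : 0 < ∣ N G v ∣
  0<∣N∣ = x∈p⇒0<∣p∣ (∈N⁺ G (proj₂ (noIsolated v)))
  N⊆S : N G v ⊆ S
  N⊆S {u} u∈N with u ∈? S
  ... | yes u∈S = u∈S
  ... | no u∉S = ⊥-elim (none (u , ∈N⁻ G u∈N , u∉S))
  q∣N∣≤p∣N∣ : q * ∣ N G v ∣ ≤ p * ∣ N G v ∣
  q∣N∣≤p∣N∣ = ≤-trans (*-monoʳ-≤ q (p⊆q⇒∣p∣≤∣q∣ (λ u∈N → x∈p∩q⁺ (u∈N , N⊆S u∈N))))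
                      (packing v v∉S)

outsideNeighbour⇒halfInside : ∀ {n} (G : Graph n) {E a b} → AtMostTwoNeighbours G →
  Adjacent G a b → b ∉ E → 2 * ∣ N G a ∩ E ∣ ≤ 1 * ∣ N G a ∣
outsideNeighbour⇒halfInside G {E} {a} {b} atMostTwo ab b∉E =
  j≤1⇒j<k⇒2*j≤k (∣p∣≤1 unique)
    (p⊂q⇒∣p∣<∣q∣ (p∩q⊆p (N G a) E , b , ∈N⁺ G ab , b∉E ∘ proj₂ ∘ x∈p∩q⁻ (N G a) E))
  where
  unique : ∀ {x y} → x ∈ N G a ∩ E → y ∈ N G a ∩ E → x ≡ y
  unique x∈ y∈ with x∈p∩q⁻ (N G a) E x∈ | x∈p∩q⁻ (N G a) E y∈
  ... | ax , x∈E | ay , y∈E with atMostTwo (∈N⁻ G ax) (∈N⁻ G ay) ab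
  ...   | inj₁ x≡y         = x≡y
  ...   | inj₂ (inj₁ refl) = ⊥-elim (b∉E y∈E)
  ...   | inj₂ (inj₂ refl) = ⊥-elim (b∉E x∈E)

∁edge-hasHalfPackingProperty : ∀ {n} {G : Graph n} {u v} →
  Symmetric (Adjacent G) → AtMostTwoNeighbours G →
  Adjacent G u v → HasPackingProperty 1 2 G (∁ (⁅ u ⁆ ∪ ⁅ v ⁆))
∁edge-hasHalfPackingProperty {G = G} symmetric atMostTwo uv w w∉E
  with ∈⁅x⁆∪⁅y⁆⁻ (x∉∁p⇒x∈p w∉E)
... | inj₁ refl = outsideNeighbour⇒halfInside G atMostTwo uv (x∈p⇒x∉∁p y∈⁅x⁆∪⁅y⁆)
... | inj₂ refl = outsideNeighbour⇒halfInside G atMostTwo (symmetric uv) (x∈p⇒x∉∁p x∈⁅x⁆∪⁅y⁆)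

module _ {n} {G : Graph n} (degrees : DegreesOneOrTwo G) where
  open DegreesOneOrTwo degrees

  halfOutsideNeighbour : ∀ {S v} → HasPackingProperty 1 2 G S → v ∉ S →
    ∃ λ u → Adjacent G v u × u ∉ S
  halfOutsideNeighbour = outsideNeighbour {p = 1} {q = 2} (s≤s (s≤s z≤n)) noIsolatedVertex

  ∁edge-isHalfPackingSet : ∀ {u v} → Adjacent G u v → IsHalfPackingSet G (∁ (⁅ u ⁆ ∪ ⁅ v ⁆))
  ∁edge-isHalfPackingSet {u} {v} uv = (u , x∈p⇒x∉∁p x∈⁅x⁆∪⁅y⁆) , packing , maximal
    where
    E = ∁ (⁅ u ⁆ ∪ ⁅ v ⁆)
    packing : HasPackingProperty 1 2 G E
    packing = ∁edge-hasHalfPackingProperty symmetric atMostTwoNeighbours uv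
    endpoint : ∀ {x} → x ∉ E → x ≡ u ⊎ x ≡ v
    endpoint = ∈⁅x⁆∪⁅y⁆⁻ ∘ x∉∁p⇒x∈p
    -- T misses a vertex w and then, by its packing property, a neighbour w′
    -- of w; both are endpoints of uv, hence T misses all of u and v.
    maximal : ∀ T → Proper T → HasPackingProperty 1 2 G T → E ⊆ T → T ⊆ E
    maximal T (w , w∉T) packingT E⊆T {x} x∈T with x ∈? E
    ... | yes x∈E = x∈E
    ... | no x∉E with halfOutsideNeighbour packingT w∉T
    ... | w′ , ww′ , w′∉T =
      ⊥-elim ([ (λ { refl → w∉T x∈T }) , (λ { refl → w′∉T x∈T }) ]
        (pair-cover (λ w≡w′ → irreflexive w≡w′ ww′)
          (endpoint (w∉T ∘ E⊆T)) (endpoint (w′∉T ∘ E⊆T)) (endpoint x∉E)))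

  halfPackingSet⇒∁edge : ∀ {S} → IsHalfPackingSet G S →
    ∃₂ λ u v → Adjacent G u v × S ≡ ∁ (⁅ u ⁆ ∪ ⁅ v ⁆)
  halfPackingSet⇒∁edge {S} ((v , v∉S) , packing , maximal) with halfOutsideNeighbour packing v∉S
  ... | u , vu , u∉S =
    v , u , vu , ⊆-antisym S⊆E (maximal E (proj₁ E-isPacking) (proj₁ (proj₂ E-isPacking)) S⊆E)
    where
    E = ∁ (⁅ v ⁆ ∪ ⁅ u ⁆)
    E-isPacking = ∁edge-isHalfPackingSet vu
    S⊆E : S ⊆ E
    S⊆E x∈S = x∉p⇒x∈∁p ([ (λ { refl → v∉S x∈S }) , (λ { refl → u∉S x∈S }) ] ∘ ∈⁅x⁆∪⁅y⁆⁻)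

  ∣∁edge∣≡n∸2 : ∀ u v → Adjacent G u v → ∣ ∁ (⁅ u ⁆ ∪ ⁅ v ⁆) ∣ ≡ n ∸ 2
  ∣∁edge∣≡n∸2 u v uv =
    trans (∣∁p∣≡n∸∣p∣ (⁅ u ⁆ ∪ ⁅ v ⁆)) (cong (n ∸_) (∣⁅x⁆∪⁅y⁆∣≡2 (λ u≡v → irreflexive u≡v uv)))

  -- The vertex argument rules out the empty graph, which has no proper subset.
  halfPackingNumber≡n∸2 : Fin n → IsHalfPackingNumber G (n ∸ 2)
  halfPackingNumber≡n∸2 v =
    (_ , ∁edge-isHalfPackingSet vu , ∣∁edge∣≡n∸2 v _ vu) , λ _ → ≤-reflexive ∘ size
    where
    vu = proj₂ (noIsolatedVertex v)
    size : ∀ {S} → IsHalfPackingSet G S → ∣ S ∣ ≡ n ∸ 2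
    size S-isPacking with halfPackingSet⇒∁edge S-isPacking
    ... | u , v , uv , refl = ∣∁edge∣≡n∸2 u v uv

  edge-inducedConnected : ∀ u v {X} → Adjacent G u v → X ⊆ ⁅ u ⁆ ∪ ⁅ v ⁆ →
    InducedConnected G X
  edge-inducedConnected u v uv X⊆uv a b a∈X b∈X
    with ∈⁅x⁆∪⁅y⁆⁻ (X⊆uv a∈X) | ∈⁅x⁆∪⁅y⁆⁻ (X⊆uv b∈X)
  ... | inj₁ refl | inj₁ refl = here a∈X
  ... | inj₂ refl | inj₂ refl = here a∈X
  ... | inj₁ refl | inj₂ refl = step a∈X uv (here b∈X)
  ... | inj₂ refl | inj₁ refl = step a∈X (symmetric uv) (here b∈X)

  halfPackingSet-∁-connected : ∀ {S} → IsHalfPackingSet G S → InducedConnected G (∁ S)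
  halfPackingSet-∁-connected S-isPacking with halfPackingSet⇒∁edge S-isPacking
  ... | u , v , uv , refl = edge-inducedConnected u v uv (x∉∁p⇒x∈p ∘ x∈∁p⇒x∉p)

pathAdjacent⁻ : ∀ {n} (i j : Fin n) → Adjacent (pathGraph n) i j →
  toℕ i ≡ suc (toℕ j) ⊎ toℕ j ≡ suc (toℕ i)
pathAdjacent⁻ i j = Sum.map (≡ᵇ⇒≡ _ _) (≡ᵇ⇒≡ _ _) ∘ Equivalence.to T-∨ ∘ Equivalence.from T-≡

pathAdjacent⁺ : ∀ {n} (i j : Fin n) → toℕ i ≡ suc (toℕ j) → Adjacent (pathGraph n) i j
pathAdjacent⁺ i j = Equivalence.to T-≡ ∘ Equivalence.from T-∨ ∘ inj₁ ∘ ≡⇒≡ᵇ _ _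

ℕ-atMostTwoNeighbours : ∀ {a x y z : ℕ} →
  a ≡ suc x ⊎ x ≡ suc a → a ≡ suc y ⊎ y ≡ suc a → a ≡ suc z ⊎ z ≡ suc a →
  x ≡ y ⊎ y ≡ z ⊎ x ≡ z
ℕ-atMostTwoNeighbours (inj₁ refl) (inj₁ q)    _           = inj₁ (suc-injective q)
ℕ-atMostTwoNeighbours (inj₂ refl) (inj₂ refl) _           = inj₁ refl
ℕ-atMostTwoNeighbours (inj₁ refl) (inj₂ refl) (inj₁ r)    = inj₂ (inj₂ (suc-injective r))
ℕ-atMostTwoNeighbours (inj₁ refl) (inj₂ refl) (inj₂ refl) = inj₂ (inj₁ refl)
ℕ-atMostTwoNeighbours (inj₂ refl) (inj₁ q)    (inj₁ r)    = inj₂ (inj₁ (suc-injective (trans (sym q) r)))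
ℕ-atMostTwoNeighbours (inj₂ refl) (inj₁ q)    (inj₂ refl) = inj₂ (inj₂ refl)

pathGraph-symmetric : ∀ {n} → Symmetric (Adjacent (pathGraph n))
pathGraph-symmetric {x = i} {j} = trans (∨-comm (toℕ j ≡ᵇ suc (toℕ i)) (toℕ i ≡ᵇ suc (toℕ j)))

pathGraph-irreflexive : ∀ {n} → Irreflexive _≡_ (Adjacent (pathGraph n))
pathGraph-irreflexive {x = i} refl = [ 1+n≢n ∘ sym , 1+n≢n ∘ sym ] ∘ pathAdjacent⁻ i i

pathGraph-noIsolatedVertex : ∀ m → NoIsolatedVertex (pathGraph (suc (suc m)))
pathGraph-noIsolatedVertex m fzero    = fsuc fzero , refl
pathGraph-noIsolatedVertex m (fsuc w) =
  inject₁ w , pathAdjacent⁺ (fsuc w) (inject₁ w) (cong suc (sym (toℕ-inject₁ w)))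

pathGraph-atMostTwoNeighbours : ∀ {n} → AtMostTwoNeighbours (pathGraph n)
pathGraph-atMostTwoNeighbours {a = a} {x} {y} {z} ax ay az =
  Sum.map toℕ-injective (Sum.map toℕ-injective toℕ-injective)
    (ℕ-atMostTwoNeighbours (pathAdjacent⁻ a x ax) (pathAdjacent⁻ a y ay) (pathAdjacent⁻ a z az))

pathGraph-degreesOneOrTwo : ∀ m → DegreesOneOrTwo (pathGraph (suc (suc m)))
pathGraph-degreesOneOrTwo m = record
  { symmetric           = λ {i j} → pathGraph-symmetric {x = i} {j}
  ; irreflexive         = pathGraph-irreflexive
  ; noIsolatedVertex    = pathGraph-noIsolatedVertex m
  ; atMostTwoNeighbours = pathGraph-atMostTwoNeighbours
  }

proposition2p1 : (n : ℕ) → 2 ≤ n →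
    IsHalfPackingNumber (pathGraph n) (n ∸ 2) ×
    ((S : Subset n) → IsHalfPackingSet (pathGraph n) S →
      InducedConnected (pathGraph n) (∁ S))
proposition2p1 (suc (suc m)) (s≤s (s≤s z≤n)) =
  halfPackingNumber≡n∸2 path fzero , λ _ → halfPackingSet-∁-connected path
  where
  path = pathGraph-degreesOneOrTwo m
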